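{- There is a function $f$ such that for every graph $G$ without isolated vertices, every uniform NROBP computing $\phi(G)$ has at least $2^{mw(G)/f(x)}$ nodes, where $x$ is the maximum degree of $G$.
   Context: For a graph $G$ without isolated vertices, $\phi(G)$ is the monotone 2-CNF formula whose variables are the vertices of $G$ and whose clauses are $(u \vee v)$ for all edges $\{u,v\} \in E(G)$. Matching width: for a permutation $SV$ of $V(G)$ and a prefix $S_1$ of $SV$, the matching width of $S_1$ is the size of a largest matching consisting of edges with one end in $S_1$ and the other in $V(G)\setminus S_1$; the matching width of $SV$ is the maximum matching width of its prefixes; $mw(G)$ is the minimum matching width over all permutations of $V(G)$. A non-deterministic read-once branching program (NROBP) computing a Boolean function $F$ is a finite directed acyclic graph, possibly with multiple edges, with exactly one root and exactly one leaf, in which some edges are labelled by literals of variables of $F$, such that no directed path contains two edges labelled by literals of the same variable. For a directed path $P$, $A(P)$ is the set of literals labelling edges of $P$. It computes $F$ if (i) for every root-leaf path $P$, every truth assignment to all variables of $F$ containing $A(P)$ satisfies $F$, and (ii) for every satisfying assignment $A$ of $F$ there is a root-leaf path $P$ with $A(P) \subseteq A$. It is uniform if for every node $a$, any two root-to-$a$ paths are labelled by literals of the same set of variables, and every root-leaf path is labelled by literals of all variables of $F$. -}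

module Defs where

open import Data.Nat using (ℕ; zero; suc; _+_; _≤_; _<_; _⊔_)
open import Data.Fin using (Fin; toℕ)
open import Data.Fin.Permutation using (Permutation′; _⟨$⟩ˡ_)
open import Data.Bool using (Bool; true; false)
open import Data.List using (List; []; _∷_; map; length; foldr; filter)
open import Data.List.Base using (upTo)
open import Data.List.Membership.Propositional using (_∈_)
open import Data.List.Relation.Unary.All using (All)
open import Data.List.Relation.Unary.Unique.Propositional using (Unique)
open import Data.Maybe using (Maybe; just; nothing)
open import Data.Product using (Σ; ∃; ∃-syntax; _×_; _,_; proj₁; proj₂)
open import Data.Sum using (_⊎_)
open import Relation.Binary.PropositionalEquality using (_≡_)
open import Relation.Nullary using (¬_)
open import Function.Bundles using (_⇔_)
open import Data.Bool.Properties using (T?)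
open import Data.Bool using (T)
import Data.List.Base as L

record Graph (n : ℕ) : Set where
  field
    adj    : Fin n → Fin n → Bool
    sym    : ∀ u v → adj u v ≡ adj v u
    irrefl : ∀ v → adj v v ≡ false

open Graph public

Edge : ∀ {n} → Graph n → Fin n → Fin n → Set
Edge G u v = adj G u v ≡ true

NoIsolatedVertices : ∀ {n} → Graph n → Set
NoIsolatedVertices {n} G = ∀ (v : Fin n) → ∃[ u ] Edge G v u

degree : ∀ {n} → Graph n → Fin n → ℕ
degree {n} G v = length (filter (λ u → T? (adj G v u)) (L.allFin n))

maxDegree : ∀ {n} → Graph n → ℕ
maxDegree {n} G = foldr _⊔_ 0 (map (degree G) (L.allFin n))

Greatest : (ℕ → Set) → ℕ → Set
Greatest P w = P w × (∀ m → P m → m ≤ w)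

Least : (ℕ → Set) → ℕ → Set
Least P w = P w × (∀ m → P m → w ≤ m)

IsCrossMatching : ∀ {n} → Graph n → (Fin n → Set) → List (Fin n × Fin n) → Set
IsCrossMatching G S M =
  All (λ e → Edge G (proj₁ e) (proj₂ e) × S (proj₁ e) × ¬ S (proj₂ e)) M
  × Unique (map proj₁ M) × Unique (map proj₂ M)

MatchingWidthOfSet : ∀ {n} → Graph n → (Fin n → Set) → ℕ → Set
MatchingWidthOfSet G S =
  Greatest (λ m → Σ _ λ M → IsCrossMatching G S M × length M ≡ m)

-- the prefix of length k of the ordering σ (σ maps positions to vertices)
Prefix : ∀ {n} → Permutation′ n → ℕ → Fin n → Set
Prefix σ k v = toℕ (σ ⟨$⟩ˡ v) < k

MatchingWidthOfPerm : ∀ {n} → Graph n → Permutation′ n → ℕ → Set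
MatchingWidthOfPerm {n} G σ =
  Greatest (λ m → ∃[ k ] (k ≤ n × MatchingWidthOfSet G (Prefix σ k) m))

MatchingWidth : ∀ {n} → Graph n → ℕ → Set
MatchingWidth G = Least (λ m → ∃[ σ ] MatchingWidthOfPerm G σ m)

Assignment : ℕ → Set
Assignment n = Fin n → Bool

BoolFun : ℕ → Set₁
BoolFun n = Assignment n → Set

phi : ∀ {n} → Graph n → BoolFun n
phi G a = ∀ u v → Edge G u v → (a u ≡ true) ⊎ (a v ≡ true)

-- literal: variable with polarity (x , true) = x, (x , false) = ¬x
Literal : ℕ → Set
Literal n = Fin n × Bool

Contains : ∀ {n} → Assignment n → Literal n → Set
Contains a (x , b) = a x ≡ b

record BP (n : ℕ) : Set where
  field
    N     : ℕ
    m     : ℕ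
    src   : Fin m → Fin N
    tgt   : Fin m → Fin N
    label : Fin m → Maybe (Literal n)

  data Path : Fin N → Fin N → Set where
    []  : ∀ {a} → Path a a
    step : ∀ {a b} (e : Fin m) → src e ≡ a → Path (tgt e) b → Path a b

  labels : ∀ {a b} → Path a b → List (Literal n)
  labels [] = []
  labels (step e _ p) with label e
  ... | just l  = l ∷ labels p
  ... | nothing = labels p

  vars : ∀ {a b} → Path a b → List (Fin n)
  vars p = map proj₁ (labels p)

  NonEmpty : ∀ {a b} → Path a b → Set
  NonEmpty []      = Data.Empty.⊥ where import Data.Empty
  NonEmpty (step _ _ _) = Data.Unit.⊤ where import Data.Unit

  Acyclic : Set
  Acyclic = ∀ a → (p : Path a a) → ¬ NonEmpty p

  IsRoot : Fin N → Set
  IsRoot a = ∀ e → ¬ tgt e ≡ a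

  IsLeaf : Fin N → Set
  IsLeaf a = ∀ e → ¬ src e ≡ a

  ReadOnce : Set
  ReadOnce = ∀ a b → (p : Path a b) → Unique (vars p)

open BP public

record NROBP (n : ℕ) : Set where
  field
    prog      : BP n
    acyclic   : Acyclic prog
    readOnce  : ReadOnce prog
    root      : Fin (N prog)
    leaf      : Fin (N prog)
    rootRoot  : IsRoot prog root
    rootUniq  : ∀ a → IsRoot prog a → a ≡ root
    leafLeaf  : IsLeaf prog leaf
    leafUniq  : ∀ a → IsLeaf prog a → a ≡ leaf

open NROBP public

nodes : ∀ {n} → NROBP n → ℕ
nodes P = N (prog P)

Computes : ∀ {n} → NROBP n → BoolFun n → Set
Computes P F =
  (∀ (p : Path (prog P) (root P) (leaf P)) (a : Assignment _) →
     All (Contains a) (labels (prog P) p) → F a)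
  × (∀ (a : Assignment _) → F a →
     Σ (Path (prog P) (root P) (leaf P)) λ p → All (Contains a) (labels (prog P) p))

Uniform : ∀ {n} → NROBP n → Set
Uniform {n} P =
  (∀ c (p q : Path (prog P) (root P) c) (x : Fin n) →
     (x ∈ vars (prog P) p) ⇔ (x ∈ vars (prog P) q))
  × (∀ (p : Path (prog P) (root P) (leaf P)) (x : Fin n) → x ∈ vars (prog P) p)

-- Send each vertex cover a of G (a satisfying assignment of phi G) to a node of P as follows.
-- The variables read along an accepting path of a form an ordering of V(G), so some prefix of
-- it is crossed by a matching M of size w = mw(G); a is sent to the node c where the path
-- has read exactly that prefix. By uniformity every cover sent to c reads the same variables
-- before c, and gluing the first half of one such path to the second half of another is again
-- an accepting path. Hence for each edge uv of M, either u or v is true in every cover sent to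
-- c, so these covers all contain one fixed w-set D. Switching a vertex d off after switching
-- its neighbours on shows that, with K = 2^Δ, the covers containing D ∪ {d} are at most a
-- K/(K+1) fraction of those containing D. So each node receives at most a (K/(K+1))^w
-- fraction of the covers, whence nodes P ≥ ((K+1)/K)^w ≥ 2^(w/K).

module Submission where

open import Algebra.Properties.CommutativeSemigroup using (interchange)
open import Axiom.UniquenessOfIdentityProofs using (module Decidable⇒UIP)
open import Data.Bool using (Bool; true; false; T; if_then_else_)
open import Data.Bool.Properties using (T?) renaming (_≟_ to _≟ᴮ_)
open import Data.Empty using (⊥-elim)
open import Data.Fin using (Fin; zero; suc; toℕ; punchOut)
import Data.Fin.Properties as Fin
open import Data.Fin.Permutation using (Permutation; Permutation′; permutation; _⟨$⟩ˡ_; ↔⇒≡)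
open import Data.List using (List; []; _∷_; _++_; length; filter; take; drop)
import Data.List.Base as List
open import Data.List.Membership.Propositional using (_∈_; _∉_)
open import Data.List.Membership.Propositional.Properties using (∈-filter⁺; ∈-allFin; ∈-lookup; ∈-map⁺; ∈-++⁺ʳ)
open import Data.List.Membership.Setoid.Properties using (unique⇒irrelevant)
open import Data.List.Properties using (length-map; length-take; take-map; map-++)
open import Data.List.Relation.Unary.All as All using (All; []; _∷_)
import Data.List.Relation.Unary.All.Properties as All
open import Data.List.Relation.Unary.Any using (here; there; index)
open import Data.List.Relation.Unary.Any.Properties using (lookup-index)
open import Data.List.Relation.Unary.Unique.Propositional using (Unique; []; _∷_)
import Data.List.Relation.Unary.Unique.Propositional.Properties as Unique
open import Data.Maybe using (just; nothing)
open import Data.Nat using (ℕ; zero; suc; _+_; _*_; _^_; _⊔_; _≤_; _<_; z≤n; s≤s; NonZero; >-nonZero)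
open import Data.Nat.Properties
open import Data.Nat.Tactic.RingSolver using (solve-∀)
open import Data.Product using (Σ; ∃; ∃-syntax; _×_; _,_; proj₁; proj₂)
open import Data.Sum as Sum using (_⊎_; inj₁; inj₂)
open import Data.Vec using (Vec; []; _∷_; lookup; insertAt; replicate)
open import Data.Vec.Properties using (insertAt-lookup; insertAt-punchIn; lookup-replicate)
open import Function using (_∘_; case_of_)
open import Function.Bundles using (_⇔_; mk⇔; Equivalence)
open import Level using (0ℓ)
open import Relation.Binary.PropositionalEquality
open import Relation.Nullary using (Dec; yes; no; ¬_)
open import Relation.Nullary.Decidable using (map′; does; _×-dec_; _⊎-dec_; _→-dec_; ¬?)
open import Relation.Unary using (Pred; Decidable; _⊆_; _∩_; ∁; Satisfiable)
open import Relation.Unary.Properties using (_∩?_; ∁?)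

open import Defs hiding (sym)

-- Counting assignments

count : ∀ {n} {P : Pred (Vec Bool n) 0ℓ} → Decidable P → ℕ
count {zero} P? with P? []
... | yes _ = 1
... | no _  = 0
count {suc n} P? = count (P? ∘ (true ∷_)) + count (P? ∘ (false ∷_))

private
  variable
    n : ℕ
    P Q : Pred (Vec Bool n) 0ℓ

count-mono : (P? : Decidable P) (Q? : Decidable Q) → P ⊆ Q → count P? ≤ count Q?
count-mono {zero} P? Q? P⊆Q with P? [] | Q? []
... | yes _ | yes _  = ≤-refl
... | yes p | no ¬q  = ⊥-elim (¬q (P⊆Q p))
... | no _  | _      = z≤n
count-mono {suc n} P? Q? P⊆Q =
  +-mono-≤ (count-mono (P? ∘ (true ∷_)) (Q? ∘ (true ∷_)) P⊆Q)
           (count-mono (P? ∘ (false ∷_)) (Q? ∘ (false ∷_)) P⊆Q)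

∈⇒0<count : (P? : Decidable P) {a : Vec Bool n} → P a → 0 < count P?
∈⇒0<count {zero} P? {[]} p with P? []
... | yes _ = s≤s z≤n
... | no ¬p = ⊥-elim (¬p p)
∈⇒0<count {suc n} P? {true ∷ a} p = ≤-trans (∈⇒0<count (P? ∘ (true ∷_)) p) (m≤m+n _ _)
∈⇒0<count {suc n} P? {false ∷ a} p = ≤-trans (∈⇒0<count (P? ∘ (false ∷_)) p) (m≤n+m _ _)

0<count⇒satisfiable : (P? : Decidable P) → 0 < count P? → Satisfiable P
0<count⇒satisfiable {zero} P? 0<c with P? []
... | yes p = [] , p
0<count⇒satisfiable {suc n} P? 0<c with count (P? ∘ (true ∷_)) in eq
... | suc _ = let a , p = 0<count⇒satisfiable (P? ∘ (true ∷_)) (subst (0 <_) (sym eq) (s≤s z≤n)) in true ∷ a , p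
... | zero  = let a , p = 0<count⇒satisfiable (P? ∘ (false ∷_)) 0<c in false ∷ a , p

satisfiable? : Decidable P → Dec (Satisfiable P)
satisfiable? P? = map′ (0<count⇒satisfiable P?) (λ (a , p) → ∈⇒0<count P? p) (0 <? count P?)

+-interchange : ∀ a b c d → (a + b) + (c + d) ≡ (a + c) + (b + d)
+-interchange = interchange +-commutativeSemigroup

count-∩-∁ : (P? : Decidable P) (Q? : Decidable Q) →
  count P? ≡ count (P? ∩? Q?) + count (P? ∩? ∁? Q?)
count-∩-∁ {zero} P? Q? with P? [] | Q? []
... | yes _ | yes _ = refl
... | yes _ | no _  = refl
... | no _  | yes _ = refl
... | no _  | no _  = refl
count-∩-∁ {suc n} P? Q? =
  trans (cong₂ _+_ (count-∩-∁ Pᵗ Qᵗ) (count-∩-∁ Pᶠ Qᶠ))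
        (+-interchange (count (Pᵗ ∩? Qᵗ)) (count (Pᵗ ∩? ∁? Qᵗ))
                       (count (Pᶠ ∩? Qᶠ)) (count (Pᶠ ∩? ∁? Qᶠ)))
  where
  Pᵗ = P? ∘ (true ∷_)
  Pᶠ = P? ∘ (false ∷_)
  Qᵗ = Q? ∘ (true ∷_)
  Qᶠ = Q? ∘ (false ∷_)

count-insertAt : {P : Pred (Vec Bool (suc n)) 0ℓ} (P? : Decidable P) (y : Fin (suc n)) →
  count P? ≡ count (λ r → P? (insertAt r y true)) + count (λ r → P? (insertAt r y false))
count-insertAt P? zero = refl
count-insertAt {suc n} P? (suc y) =
  trans (cong₂ _+_ (count-insertAt Pᵗ y) (count-insertAt Pᶠ y))
        (+-interchange (count (λ r → Pᵗ (insertAt r y true))) (count (λ r → Pᵗ (insertAt r y false)))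
                       (count (λ r → Pᶠ (insertAt r y true))) (count (λ r → Pᶠ (insertAt r y false))))
  where
  Pᵗ = P? ∘ (true ∷_)
  Pᶠ = P? ∘ (false ∷_)

∑ : ∀ N → (Fin N → ℕ) → ℕ
∑ zero    f = 0
∑ (suc N) f = f zero + ∑ N (f ∘ suc)

∑-+ : ∀ N (f g : Fin N → ℕ) → ∑ N (λ i → f i + g i) ≡ ∑ N f + ∑ N g
∑-+ zero    f g = refl
∑-+ (suc N) f g =
  trans (cong (f zero + g zero +_) (∑-+ N (f ∘ suc) (g ∘ suc)))
        (+-interchange (f zero) (g zero) (∑ N (f ∘ suc)) (∑ N (g ∘ suc)))

term≤∑ : ∀ N (f : Fin N → ℕ) i → f i ≤ ∑ N f
term≤∑ (suc N) f zero    = m≤m+n _ _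
term≤∑ (suc N) f (suc i) = ≤-trans (term≤∑ N (f ∘ suc) i) (m≤n+m _ _)

∑*-≤ : ∀ N (f : Fin N → ℕ) {x y} → (∀ i → f i * x ≤ y) → ∑ N f * x ≤ N * y
∑*-≤ zero    f h = z≤n
∑*-≤ (suc N) f {x} h =
  ≤-trans (≤-reflexive (*-distribʳ-+ x (f zero) (∑ N (f ∘ suc))))
          (+-mono-≤ (h zero) (∑*-≤ N (f ∘ suc) (h ∘ suc)))

count≤∑-fibres : ∀ {N} (P? : Decidable P) (g : Vec Bool n → Fin N) →
  count P? ≤ ∑ N (λ i → count (P? ∩? λ a → g a Fin.≟ i))
count≤∑-fibres {zero} {N = N} P? g =
  ≤-trans (count-mono P? (P? ∩? λ a → g a Fin.≟ g []) λ { {[]} p → p , refl })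
          (term≤∑ N (λ i → count (P? ∩? λ a → g a Fin.≟ i)) (g []))
count≤∑-fibres {suc n} {N = N} P? g =
  ≤-trans (+-mono-≤ (count≤∑-fibres (P? ∘ (true ∷_)) (g ∘ (true ∷_)))
                    (count≤∑-fibres (P? ∘ (false ∷_)) (g ∘ (false ∷_))))
          (≤-reflexive (sym (∑-+ N (λ i → count ((P? ∘ (true ∷_)) ∩? λ a → g (true ∷ a) Fin.≟ i))
                                   (λ i → count ((P? ∘ (false ∷_)) ∩? λ a → g (false ∷ a) Fin.≟ i)))))

count*-≤ : ∀ {N} (P? : Decidable P) (g : Vec Bool n → Fin N) {x y} →
  (∀ i → count (P? ∩? λ a → g a Fin.≟ i) * x ≤ y) → count P? * x ≤ N * y
count*-≤ {N = N} P? g {x} h =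
  ≤-trans (*-monoˡ-≤ x (count≤∑-fibres P? g)) (∑*-≤ N (λ i → count (P? ∩? λ a → g a Fin.≟ i)) h)

-- Monotone predicates

record _⊑_ (a b : Vec Bool n) : Set where
  constructor mk⊑
  field ⊑-true : ∀ x → lookup a x ≡ true → lookup b x ≡ true

open _⊑_

Monotone : Pred (Vec Bool n) 0ℓ → Set
Monotone P = ∀ {a b} → a ⊑ b → P a → P b

IsTrue : Fin n → Pred (Vec Bool n) 0ℓ
IsTrue x a = lookup a x ≡ true

isTrue? : (x : Fin n) → Decidable (IsTrue x)
isTrue? x a = lookup a x ≟ᴮ true

AllTrue : List (Fin n) → Pred (Vec Bool n) 0ℓ
AllTrue ys a = All (λ x → IsTrue x a) ys

allTrue? : (ys : List (Fin n)) → Decidable (AllTrue ys)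
allTrue? ys a = All.all? (λ x → isTrue? x a) ys

IsTrue-monotone : (x : Fin n) → Monotone (IsTrue x)
IsTrue-monotone x a⊑b = ⊑-true a⊑b x

AllTrue-monotone : (ys : List (Fin n)) → Monotone (AllTrue ys)
AllTrue-monotone ys a⊑b = All.map (λ {x} → ⊑-true a⊑b x)

∩-monotone : Monotone P → Monotone Q → Monotone (P ∩ Q)
∩-monotone P↑ Q↑ a⊑b (p , q) = P↑ a⊑b p , Q↑ a⊑b q

lookup-insertAt-≢ : ∀ {A : Set} (r : Vec A n) {y x : Fin (suc n)} b (y≢x : ¬ y ≡ x) →
  lookup (insertAt r y b) x ≡ lookup r (punchOut y≢x)
lookup-insertAt-≢ r {y} b y≢x =
  trans (cong (lookup (insertAt r y b)) (sym (Fin.punchIn-punchOut y≢x)))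
        (insertAt-punchIn r y b (punchOut y≢x))

lookup-insertAt-swap : ∀ {A : Set} (r : Vec A n) {y x : Fin (suc n)} b b′ → ¬ y ≡ x →
  lookup (insertAt r y b) x ≡ lookup (insertAt r y b′) x
lookup-insertAt-swap r b b′ y≢x = trans (lookup-insertAt-≢ r b y≢x) (sym (lookup-insertAt-≢ r b′ y≢x))

insertAt-false⊑true : (r : Vec Bool n) (y : Fin (suc n)) → insertAt r y false ⊑ insertAt r y true
insertAt-false⊑true r y = mk⊑ true-preserved
  where
  true-preserved : ∀ x → lookup (insertAt r y false) x ≡ true → lookup (insertAt r y true) x ≡ true
  true-preserved x r[y≔f]ₓ with y Fin.≟ x
  ... | yes refl = insertAt-lookup r y true
  ... | no y≢x   = trans (lookup-insertAt-swap r true false y≢x) r[y≔f]ₓ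

count≤2*count-IsTrue : {P : Pred (Vec Bool (suc n)) 0ℓ} → Monotone P → (P? : Decidable P) (y : Fin (suc n)) →
  count P? ≤ 2 * count (P? ∩? isTrue? y)
count≤2*count-IsTrue P↑ P? y = begin
  count P?          ≡⟨ count-insertAt P? y ⟩
  cᵗ + cᶠ           ≤⟨ +-mono-≤ cᵗ≤c (≤-trans cᶠ≤cᵗ cᵗ≤c) ⟩
  c + c             ≡⟨ cong (c +_) (sym (+-identityʳ c)) ⟩
  2 * c             ∎
  where
  open ≤-Reasoning
  cᵗ = count (λ r → P? (insertAt r y true))
  cᶠ = count (λ r → P? (insertAt r y false))
  c = count (P? ∩? isTrue? y)
  cᶠ≤cᵗ : cᶠ ≤ cᵗ
  cᶠ≤cᵗ = count-mono (λ r → P? (insertAt r y false)) (λ r → P? (insertAt r y true))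
                     (P↑ (insertAt-false⊑true _ y))
  cᵗ≤c : cᵗ ≤ c
  cᵗ≤c = ≤-trans (count-mono (λ r → P? (insertAt r y true)) (λ r → (P? ∩? isTrue? y) (insertAt r y true))
                             (λ {r} p → p , insertAt-lookup r y true))
                 (≤-trans (m≤m+n _ _) (≤-reflexive (sym (count-insertAt (P? ∩? isTrue? y) y))))

count≤2^length*count-AllTrue : {P : Pred (Vec Bool (suc n)) 0ℓ} → Monotone P → (P? : Decidable P)
  (ys : List (Fin (suc n))) → count P? ≤ 2 ^ length ys * count (P? ∩? allTrue? ys)
count≤2^length*count-AllTrue P↑ P? [] =
  ≤-trans (count-mono P? (P? ∩? allTrue? []) (_, [])) (≤-reflexive (sym (+-identityʳ _)))
count≤2^length*count-AllTrue P↑ P? (y ∷ ys) = begin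
  count P?                                            ≤⟨ count≤2*count-IsTrue P↑ P? y ⟩
  2 * count Py?                                       ≤⟨ *-monoʳ-≤ 2 (count≤2^length*count-AllTrue (∩-monotone P↑ (IsTrue-monotone y)) Py? ys) ⟩
  2 * (2 ^ length ys * count (Py? ∩? allTrue? ys))    ≤⟨ *-monoʳ-≤ 2 (*-monoʳ-≤ (2 ^ length ys) (count-mono (Py? ∩? allTrue? ys) (P? ∩? allTrue? (y ∷ ys)) λ ((p , t) , ts) → p , t ∷ ts)) ⟩
  2 * (2 ^ length ys * count (P? ∩? allTrue? (y ∷ ys)))  ≡⟨ sym (*-assoc 2 (2 ^ length ys) _) ⟩
  2 ^ length (y ∷ ys) * count (P? ∩? allTrue? (y ∷ ys))  ∎
  where
  open ≤-Reasoning
  Py? = P? ∩? isTrue? y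

count-mono-switchOff : {P Q : Pred (Vec Bool (suc n)) 0ℓ} (P? : Decidable P) (Q? : Decidable Q) (y : Fin (suc n)) →
  P ⊆ IsTrue y → (∀ r → P (insertAt r y true) → Q (insertAt r y false)) →
  count P? ≤ count Q?
count-mono-switchOff {P = P} {Q} P? Q? y P⊆y switchOff = begin
  count P?   ≡⟨ count-insertAt P? y ⟩
  pᵗ + pᶠ    ≤⟨ +-mono-≤ (count-mono _ (λ r → Q? (insertAt r y false)) (switchOff _))
                         (count-mono _ (λ r → Q? (insertAt r y true)) y-false-absurd) ⟩
  qᶠ + qᵗ    ≡⟨ +-comm qᶠ qᵗ ⟩
  qᵗ + qᶠ    ≡⟨ count-insertAt Q? y ⟨
  count Q?   ∎
  where
  open ≤-Reasoning
  pᵗ = count (λ r → P? (insertAt r y true))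
  pᶠ = count (λ r → P? (insertAt r y false))
  qᵗ = count (λ r → Q? (insertAt r y true))
  qᶠ = count (λ r → Q? (insertAt r y false))
  y-false-absurd : ∀ {r} → P (insertAt r y false) → Q (insertAt r y true)
  y-false-absurd {r} p with () ← trans (sym (insertAt-lookup r y false)) (P⊆y p)

-- Vertex covers

module _ (G : Graph n) where

  Cover : Pred (Vec Bool n) 0ℓ
  Cover a = phi G (lookup a)

  cover? : Decidable Cover
  cover? a = Fin.all? λ u → Fin.all? λ v → (adj G u v ≟ᴮ true) →-dec (isTrue? u a ⊎-dec isTrue? v a)

  cover-monotone : Monotone Cover
  cover-monotone a⊑b cov u v uv = Sum.map (⊑-true a⊑b u) (⊑-true a⊑b v) (cov u v uv)

  CoverContaining : List (Fin n) → Pred (Vec Bool n) 0ℓ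
  CoverContaining D = Cover ∩ AllTrue D

  coverContaining? : (D : List (Fin n)) → Decidable (CoverContaining D)
  coverContaining? D = cover? ∩? allTrue? D

  neighbours : Fin n → List (Fin n)
  neighbours d = filter (λ u → T? (adj G d u)) (List.allFin n)

  ∈-neighbours : ∀ {d u} → Edge G d u → u ∈ neighbours d
  ∈-neighbours {d} {u} du = ∈-filter⁺ (λ u → T? (adj G d u)) (∈-allFin u) (subst T (sym du) _)

degree≤maxDegree : (G : Graph n) (d : Fin n) → degree G d ≤ maxDegree G
degree≤maxDegree {n} G d = ≤-foldr-⊔ (∈-map⁺ (degree G) (∈-allFin d))
  where
  ≤-foldr-⊔ : ∀ {x xs} → x ∈ xs → x ≤ List.foldr _⊔_ 0 xs
  ≤-foldr-⊔ {xs = y ∷ xs} (here refl)  = m≤m⊔n y _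
  ≤-foldr-⊔ {xs = y ∷ xs} (there x∈xs) = ≤-trans (≤-foldr-⊔ x∈xs) (m≤n⊔m y _)

module _ (G : Graph (suc n)) (r : Vec Bool n) (d : Fin (suc n)) where

  lowered-neighbour-true : AllTrue (neighbours G d) (insertAt r d true) →
    ∀ {x} → Edge G d x → lookup (insertAt r d false) x ≡ true
  lowered-neighbour-true nbrs-true {x} dx =
    trans (lookup-insertAt-swap r false true d≢x) (All.lookup nbrs-true (∈-neighbours G dx))
    where
    d≢x : ¬ d ≡ x
    d≢x refl with () ← trans (sym dx) (irrefl G d)

  lower-cover : Cover G (insertAt r d true) → AllTrue (neighbours G d) (insertAt r d true) →
    Cover G (insertAt r d false)
  lower-cover cov nbrs-true u v uv with d Fin.≟ u | d Fin.≟ v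
  ... | yes refl | _        = inj₂ (lowered-neighbour-true nbrs-true uv)
  ... | no _     | yes refl = inj₁ (lowered-neighbour-true nbrs-true (trans (Graph.sym G d u) uv))
  ... | no d≢u   | no d≢v   =
    Sum.map (trans (lookup-insertAt-swap r false true d≢u)) (trans (lookup-insertAt-swap r false true d≢v))
            (cov u v uv)

  lower-allTrue : ∀ {D} → d ∉ D → AllTrue D (insertAt r d true) → AllTrue D (insertAt r d false)
  lower-allTrue d∉D D-true = All.tabulate λ {x} x∈D →
    trans (lookup-insertAt-swap r {d} {x} false true λ { refl → d∉D x∈D }) (All.lookup D-true x∈D)

module _ (G : Graph (suc n)) {D : List (Fin (suc n))} {d : Fin (suc n)} (d∉D : d ∉ D) where

  -- Once all neighbours of d are true, at a cost of 2 ^ degree G d, switching d off keeps a cover.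
  count-IsTrue≤2^degree*count-IsFalse :
    count (coverContaining? G D ∩? isTrue? d)
      ≤ 2 ^ degree G d * count (coverContaining? G D ∩? ∁? (isTrue? d))
  count-IsTrue≤2^degree*count-IsFalse =
    ≤-trans (count≤2^length*count-AllTrue R↑ R? (neighbours G d))
            (*-monoʳ-≤ (2 ^ degree G d)
              (count-mono-switchOff (R? ∩? allTrue? (neighbours G d)) (coverContaining? G D ∩? ∁? (isTrue? d)) d
                          (proj₂ ∘ proj₁) lower))
    where
    R? = coverContaining? G D ∩? isTrue? d
    R↑ : Monotone (CoverContaining G D ∩ IsTrue d)
    R↑ = ∩-monotone (∩-monotone (cover-monotone G) (AllTrue-monotone D)) (IsTrue-monotone d)
    lower : ∀ r → ((CoverContaining G D ∩ IsTrue d) ∩ AllTrue (neighbours G d)) (insertAt r d true) →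
            (CoverContaining G D ∩ ∁ (IsTrue d)) (insertAt r d false)
    lower r (((cov , D-true) , _) , nbrs-true) =
      (lower-cover G r d cov nbrs-true , lower-allTrue G r d d∉D D-true) ,
      λ d-true → case trans (sym (insertAt-lookup r d false)) d-true of λ ()

module _ {K} (G : Graph (suc n)) (2^degree≤K : ∀ d → 2 ^ degree G d ≤ K)
         {D : List (Fin (suc n))} {d : Fin (suc n)} (d∉D : d ∉ D) where

  count-coverContaining-∷ :
    suc K * count (coverContaining? G (d ∷ D)) ≤ K * count (coverContaining? G D)
  count-coverContaining-∷ = begin
    suc K * count (coverContaining? G (d ∷ D))  ≤⟨ *-monoʳ-≤ (suc K) c≤c₁ ⟩
    suc K * c₁                                  ≡⟨⟩
    c₁ + K * c₁                                 ≤⟨ +-monoˡ-≤ (K * c₁) c₁≤K*c₀ ⟩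
    K * c₀ + K * c₁                             ≡⟨ *-distribˡ-+ K c₀ c₁ ⟨
    K * (c₀ + c₁)                               ≡⟨ cong (K *_) (+-comm c₀ c₁) ⟩
    K * (c₁ + c₀)                               ≡⟨ cong (K *_) (count-∩-∁ (coverContaining? G D) (isTrue? d)) ⟨
    K * count (coverContaining? G D)            ∎
    where
    open ≤-Reasoning
    c₁ = count (coverContaining? G D ∩? isTrue? d)
    c₀ = count (coverContaining? G D ∩? ∁? (isTrue? d))
    c≤c₁ : count (coverContaining? G (d ∷ D)) ≤ c₁
    c≤c₁ = count-mono (coverContaining? G (d ∷ D)) (coverContaining? G D ∩? isTrue? d)
                      λ { (cov , d-true ∷ D-true) → (cov , D-true) , d-true }
    c₁≤K*c₀ : c₁ ≤ K * c₀
    c₁≤K*c₀ = ≤-trans (count-IsTrue≤2^degree*count-IsFalse G d∉D) (*-monoˡ-≤ c₀ (2^degree≤K d))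

count-coverContaining : ∀ {K} (G : Graph n) → (∀ d → 2 ^ degree G d ≤ K) → {D : List (Fin n)} → Unique D →
  count (coverContaining? G D) * suc K ^ length D ≤ K ^ length D * count (cover? G)
count-coverContaining G 2^degree≤K {[]} [] =
  ≤-trans (≤-reflexive (*-identityʳ _))
          (≤-trans (count-mono (coverContaining? G []) (cover? G) proj₁) (≤-reflexive (sym (+-identityʳ _))))
count-coverContaining {suc n} {K} G 2^degree≤K {d ∷ D} d∷D!@(_ ∷ D!) = begin
  c * (suc K * suc K ^ l)  ≡⟨ *-assoc c (suc K) (suc K ^ l) ⟨
  c * suc K * suc K ^ l    ≡⟨ cong (_* suc K ^ l) (*-comm c (suc K)) ⟩
  suc K * c * suc K ^ l    ≤⟨ *-monoˡ-≤ (suc K ^ l) (count-coverContaining-∷ G 2^degree≤K (Unique.Unique[x∷xs]⇒x∉xs d∷D!)) ⟩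
  K * c′ * suc K ^ l       ≡⟨ *-assoc K c′ (suc K ^ l) ⟩
  K * (c′ * suc K ^ l)     ≤⟨ *-monoʳ-≤ K (count-coverContaining G 2^degree≤K D!) ⟩
  K * (K ^ l * c₀)         ≡⟨ *-assoc K (K ^ l) c₀ ⟨
  K * K ^ l * c₀           ∎
  where
  open ≤-Reasoning
  c = count (coverContaining? G (d ∷ D))
  c′ = count (coverContaining? G D)
  c₀ = count (cover? G)
  l = length D

-- Orderings from enumerations

module _ {A : Set} where

  index-∈-lookup : ∀ (xs : List A) i → index (∈-lookup {xs = xs} i) ≡ i
  index-∈-lookup (x ∷ xs) zero    = refl
  index-∈-lookup (x ∷ xs) (suc i) = cong suc (index-∈-lookup xs i)

  index<⇒∈-take : ∀ {x : A} {xs} k (x∈xs : x ∈ xs) → toℕ (index x∈xs) < k → x ∈ take k xs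
  index<⇒∈-take (suc k) (here x≡y)  _         = here x≡y
  index<⇒∈-take (suc k) (there x∈xs) (s≤s i<k) = there (index<⇒∈-take k x∈xs i<k)

  ∈-take⇒index< : ∀ {x : A} {xs} k → x ∈ take k xs → Σ (x ∈ xs) λ x∈xs → toℕ (index x∈xs) < k
  ∈-take⇒index< {xs = y ∷ xs} (suc k) (here x≡y)  = here x≡y , s≤s z≤n
  ∈-take⇒index< {xs = y ∷ xs} (suc k) (there x∈take) =
    let x∈xs , i<k = ∈-take⇒index< k x∈take in there x∈xs , s≤s i<k

unique-++⇒disjoint : ∀ {A : Set} (xs : List A) {ys x} → Unique (xs ++ ys) → x ∈ xs → x ∉ ys
unique-++⇒disjoint (y ∷ xs) (y∉ ∷ _)   (here refl)  x∈ys = All.lookup y∉ (∈-++⁺ʳ xs x∈ys) refl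
unique-++⇒disjoint (y ∷ xs) (_ ∷ xs!)  (there x∈xs) x∈ys = unique-++⇒disjoint xs xs! x∈xs x∈ys

toℕ-subst-⟨$⟩ˡ : ∀ {m m′ n} (m≡m′ : m ≡ m′) (π : Permutation m n) x →
  toℕ (subst (λ m → Permutation m n) m≡m′ π ⟨$⟩ˡ x) ≡ toℕ (π ⟨$⟩ˡ x)
toℕ-subst-⟨$⟩ˡ refl π x = refl

enumeration⇒ordering : {L : List (Fin n)} → Unique L → (∀ x → x ∈ L) →
  ∃[ σ ] ∀ k x → Prefix σ k x ⇔ x ∈ take k L
enumeration⇒ordering {n} {L} L! enum = σ , λ k x →
  mk⇔ (λ i<k → index<⇒∈-take k (enum x) (subst (_< k) (toℕ-subst-⟨$⟩ˡ (↔⇒≡ π) π x) i<k))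
      (λ x∈take → let x∈L , i<k = ∈-take⇒index< k x∈take in
        subst (_< k) (sym (trans (toℕ-subst-⟨$⟩ˡ (↔⇒≡ π) π x) (cong (toℕ ∘ index) (∈-irrelevant (enum x) x∈L)))) i<k)
  where
  ∈-irrelevant : ∀ {x} (p q : x ∈ L) → p ≡ q
  ∈-irrelevant = unique⇒irrelevant (setoid (Fin n)) (Decidable⇒UIP.≡-irrelevant Fin._≟_) L!
  π : Permutation (length L) n
  π = permutation (List.lookup L) (index ∘ enum)
        (λ x → sym (lookup-index (enum x)))
        (λ i → trans (cong index (∈-irrelevant (enum (List.lookup L i)) (∈-lookup i))) (index-∈-lookup L i))
  σ : Permutation′ n
  σ = subst (λ m → Permutation m n) (↔⇒≡ π) π

-- Matchings and matching width

Searchable : Set → Set₁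
Searchable A = ∀ {P : Pred A 0ℓ} → Decidable P → Dec (∃ P)

×-searchable : ∀ {A B} → Searchable A → Searchable B → Searchable (A × B)
×-searchable search-A search-B P? =
  map′ (λ (a , b , p) → (a , b) , p) (λ ((a , b) , p) → a , b , p)
       (search-A λ a → search-B λ b → P? (a , b))

list-searchable : ∀ {A} → Searchable A → ∀ m {P : Pred (List A) 0ℓ} → Decidable P →
  Dec (∃ λ xs → length xs ≡ m × P xs)
list-searchable search zero P? =
  map′ (λ p → [] , refl , p) (λ { ([] , refl , p) → p }) (P? [])
list-searchable search (suc m) P? =
  map′ (λ (x , xs , len , p) → x ∷ xs , cong suc len , p)
       (λ { (x ∷ xs , len , p) → x , xs , suc-injective len , p })
       (search λ x → list-searchable search m (P? ∘ (x ∷_)))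

greatest : {P : Pred ℕ 0ℓ} → Decidable P → P 0 → ∀ b → (∀ m → P m → m ≤ b) → ∃ (Greatest P)
greatest P? p₀ zero    ≤b = 0 , p₀ , ≤b
greatest P? p₀ (suc b) ≤b with P? (suc b)
... | yes p = suc b , p , ≤b
... | no ¬p = greatest P? p₀ b λ m pₘ → case m≤n⇒m<n∨m≡n (≤b m pₘ) of λ where
  (inj₁ m<1+b) → ≤-pred m<1+b
  (inj₂ refl)  → ⊥-elim (¬p pₘ)

lookup-injective : ∀ {A : Set} {xs : List A} → Unique xs → ∀ {i j} → List.lookup xs i ≡ List.lookup xs j → i ≡ j
lookup-injective {xs = x ∷ xs} _            {zero}  {zero}  _  = refl
lookup-injective {xs = x ∷ xs} (x≢xs ∷ _)  {zero}  {suc j} eq = ⊥-elim (All.lookup x≢xs (∈-lookup j) eq)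
lookup-injective {xs = x ∷ xs} (x≢xs ∷ _)  {suc i} {zero}  eq = ⊥-elim (All.lookup x≢xs (∈-lookup i) (sym eq))
lookup-injective {xs = x ∷ xs} (_ ∷ xs!)   {suc i} {suc j} eq = cong suc (lookup-injective xs! eq)

unique⇒length≤ : {xs : List (Fin n)} → Unique xs → length xs ≤ n
unique⇒length≤ xs! = Fin.injective⇒≤ (lookup-injective xs!)

module _ (G : Graph n) where

  crossMatching? : {S : Pred (Fin n) 0ℓ} → Decidable S → Decidable (IsCrossMatching G S)
  crossMatching? S? M =
    All.all? (λ (u , v) → (adj G u v ≟ᴮ true) ×-dec S? u ×-dec ¬? (S? v)) M
      ×-dec unique? (List.map proj₁ M) ×-dec unique? (List.map proj₂ M)
    where open import Data.List.Relation.Unary.Unique.DecPropositional Fin._≟_ using (unique?)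

  crossMatching-length≤ : ∀ {S M} → IsCrossMatching G S M → length M ≤ n
  crossMatching-length≤ {M = M} (_ , fst! , _) = subst (_≤ n) (length-map proj₁ M) (unique⇒length≤ fst!)

  module _ (σ : Permutation′ n) where

    PrefixMatchingOfSize : Pred ℕ 0ℓ
    PrefixMatchingOfSize m = ∃[ k ] (k ≤ n × Σ _ λ M → IsCrossMatching G (Prefix σ k) M × length M ≡ m)

    prefixMatchingOfSize? : Decidable PrefixMatchingOfSize
    prefixMatchingOfSize? m =
      map′ (λ (k , k<1+n , M , len , M-cross) → k , ≤-pred k<1+n , M , M-cross , len)
           (λ (k , k≤n , M , M-cross , len) → k , s≤s k≤n , M , len , M-cross)
           (anyUpTo? (λ k → list-searchable (×-searchable Fin.any? Fin.any?) m
                              (crossMatching? λ v → toℕ (σ ⟨$⟩ˡ v) <? k))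
                     (suc n))

    matchingWidthOfPerm : ∃ (MatchingWidthOfPerm G σ)
    matchingWidthOfPerm =
      let w , (k , k≤n , M , M-cross , len) , maximal =
            greatest prefixMatchingOfSize? (0 , z≤n , [] , ([] , [] , []) , refl) n
                     λ m (_ , _ , M , M-cross , len) → subst (_≤ n) len (crossMatching-length≤ M-cross)
      in w , (k , k≤n , (M , M-cross , len) , λ m (M′ , M′-cross , len′) → maximal m (k , k≤n , M′ , M′-cross , len′))
           , λ m (k′ , k′≤n , (M′ , M′-cross , len′) , _) → maximal m (k′ , k′≤n , M′ , M′-cross , len′)

  crossMatching-take : ∀ {S M} k → IsCrossMatching G S M → IsCrossMatching G S (take k M)
  crossMatching-take {M = M} k (edges , fst! , snd!) =
    All.take⁺ k edges , subst Unique (take-map k M) (Unique.take⁺ k fst!)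
                      , subst Unique (take-map k M) (Unique.take⁺ k snd!)

  crossMatching-of-width : ∀ {w} → MatchingWidth G w → (σ : Permutation′ n) →
    ∃[ k ] Σ _ λ M → IsCrossMatching G (Prefix σ k) M × length M ≡ w
  crossMatching-of-width {w} (_ , minimal) σ =
    let g , σ-width = matchingWidthOfPerm σ
        k , _ , (M , M-cross , len) , _ = proj₁ σ-width
        w≤|M| = subst (w ≤_) (sym len) (minimal g (σ , σ-width))
    in k , take w M , crossMatching-take w M-cross , trans (length-take w M) (m≤n⇒m⊓n≡m w≤|M|)

  crossMatching-resp : ∀ {S S′ : Pred (Fin n) 0ℓ} {M} → (∀ x → S x ⇔ S′ x) →
    IsCrossMatching G S M → IsCrossMatching G S′ M
  crossMatching-resp S⇔S′ (edges , fst! , snd!) =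
    All.map (λ (uv , u∈S , v∉S) → uv , Equivalence.to (S⇔S′ _) u∈S , v∉S ∘ Equivalence.from (S⇔S′ _)) edges
      , fst! , snd!

  endpoint-choice-unique : ∀ {S M} (f : Fin n × Fin n → Fin n) → (∀ e → f e ≡ proj₁ e ⊎ f e ≡ proj₂ e) →
    IsCrossMatching G S M → Unique (List.map f M)
  endpoint-choice-unique {M = []}    f f-end _ = []
  endpoint-choice-unique {S} {M = e ∷ M} f f-end ((_ , e₁∈S , e₂∉S) ∷ edges , e₁∉ ∷ fst! , e₂∉ ∷ snd!) =
    All.map⁺ (All.map distinct (All.zip (edges , All.zip (All.map⁻ e₁∉ , All.map⁻ e₂∉))))
      ∷ endpoint-choice-unique f f-end (edges , fst! , snd!)
    where
    distinct : ∀ {e′} → (Edge G (proj₁ e′) (proj₂ e′) × S (proj₁ e′) × ¬ S (proj₂ e′))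
                        × ¬ proj₁ e ≡ proj₁ e′ × ¬ proj₂ e ≡ proj₂ e′ → ¬ f e ≡ f e′
    distinct {e′} ((_ , e′₁∈S , e′₂∉S) , e₁≢ , e₂≢) fe≡fe′ with f-end e | f-end e′
    ... | inj₁ fe≡e₁ | inj₁ fe′≡e′₁ = e₁≢ (trans (sym fe≡e₁) (trans fe≡fe′ fe′≡e′₁))
    ... | inj₂ fe≡e₂ | inj₂ fe′≡e′₂ = e₂≢ (trans (sym fe≡e₂) (trans fe≡fe′ fe′≡e′₂))
    ... | inj₁ fe≡e₁ | inj₂ fe′≡e′₂ = e′₂∉S (subst S (trans (sym fe≡e₁) (trans fe≡fe′ fe′≡e′₂)) e₁∈S)
    ... | inj₂ fe≡e₂ | inj₁ fe′≡e′₁ = e₂∉S (subst S (trans (sym fe′≡e′₁) (trans (sym fe≡fe′) fe≡e₂)) e′₁∈S)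

-- Paths in branching programs

module _ {B : BP n} where

  open BP.Path

  _++ᴾ_ : ∀ {a b c} → Path B a b → Path B b c → Path B a c
  []           ++ᴾ q = q
  step e eq p ++ᴾ q = step e eq (p ++ᴾ q)

  labels-++ : ∀ {a b c} (p : Path B a b) (q : Path B b c) → labels B (p ++ᴾ q) ≡ labels B p ++ labels B q
  labels-++ []           q = refl
  labels-++ (step e eq p) q with label B e
  ... | just l  = cong (l ∷_) (labels-++ p q)
  ... | nothing = labels-++ p q

  vars-++ : ∀ {a b c} (p : Path B a b) (q : Path B b c) → vars B (p ++ᴾ q) ≡ vars B p ++ vars B q
  vars-++ p q = trans (cong (List.map proj₁) (labels-++ p q)) (map-++ proj₁ (labels B p) (labels B q))

  labels-just : ∀ {a b} e (eq : src B e ≡ a) (p : Path B (tgt B e) b) {l} →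
    label B e ≡ just l → labels B (step e eq p) ≡ l ∷ labels B p
  labels-just e eq p le with label B e | le
  ... | just _ | refl = refl

  labels-nothing : ∀ {a b} e (eq : src B e ≡ a) (p : Path B (tgt B e) b) →
    label B e ≡ nothing → labels B (step e eq p) ≡ labels B p
  labels-nothing e eq p le with label B e | le
  ... | nothing | refl = refl

  record Split (a b : Fin (N B)) (ls : List (Literal n)) (k : ℕ) : Set where
    field
      {mid}        : Fin (N B)
      front        : Path B a mid
      back         : Path B mid b
      front-labels : labels B front ≡ take k ls
      back-labels  : labels B back ≡ drop k ls

  split : ∀ {a b} (p : Path B a b) k → Split a b (labels B p) k
  split p             zero    = record { front = [] ; back = p ; front-labels = refl ; back-labels = refl }
  split []            (suc k) = record { front = [] ; back = [] ; front-labels = refl ; back-labels = refl }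
  split (step e eq q) (suc k) with label B e in le
  ... | just l  = record
    { front        = step e eq (Split.front s)
    ; back         = Split.back s
    ; front-labels = trans (labels-just e eq (Split.front s) le) (cong (l ∷_) (Split.front-labels s))
    ; back-labels  = Split.back-labels s
    }
    where s = split q k
  ... | nothing = record
    { front        = step e eq (Split.front s)
    ; back         = Split.back s
    ; front-labels = trans (labels-nothing e eq (Split.front s) le) (Split.front-labels s)
    ; back-labels  = Split.back-labels s
    }
    where s = split q (suc k)

^-distribʳ-* : ∀ m n o → (m * n) ^ o ≡ m ^ o * n ^ o
^-distribʳ-* m n zero    = refl
^-distribʳ-* m n (suc o) =
  trans (cong (m * n *_) (^-distribʳ-* m n o)) (interchange′ m n (m ^ o) (n ^ o))
  where
  interchange′ : ∀ a b c d → (a * b) * (c * d) ≡ (a * c) * (b * d)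
  interchange′ = solve-∀

^-swap : ∀ m n o → (m ^ n) ^ o ≡ (m ^ o) ^ n
^-swap m n o = trans (^-*-assoc m n o) (trans (cong (m ^_) (*-comm n o)) (sym (^-*-assoc m o n)))

-- The first two terms of the binomial expansion of (K + 1)^m, multiplied by K.
K^[1+m]+m*K^m≤K*[1+K]^m : ∀ K m → K ^ suc m + m * K ^ m ≤ K * suc K ^ m
K^[1+m]+m*K^m≤K*[1+K]^m K zero    = ≤-reflexive (+-identityʳ _)
K^[1+m]+m*K^m≤K*[1+K]^m K (suc m) = begin
  K * (K * x) + suc m * (K * x)            ≤⟨ m≤m+n _ (m * x) ⟩
  K * (K * x) + suc m * (K * x) + m * x    ≡⟨ regroup K m x ⟩
  suc K * (K * x + m * x)                  ≤⟨ *-monoʳ-≤ (suc K) (K^[1+m]+m*K^m≤K*[1+K]^m K m) ⟩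
  suc K * (K * suc K ^ m)                  ≡⟨ *-comm-middle (suc K) K (suc K ^ m) ⟩
  K * (suc K * suc K ^ m)                  ∎
  where
  open ≤-Reasoning
  x = K ^ m
  regroup : ∀ K m x → K * (K * x) + suc m * (K * x) + m * x ≡ suc K * (K * x + m * x)
  regroup = solve-∀
  *-comm-middle : ∀ a b c → a * (b * c) ≡ b * (a * c)
  *-comm-middle = solve-∀

2*K^K≤[1+K]^K : ∀ K .{{_ : NonZero K}} → 2 * K ^ K ≤ suc K ^ K
2*K^K≤[1+K]^K K = *-cancelˡ-≤ K (subst (_≤ K * suc K ^ K) (double K (K ^ K)) (K^[1+m]+m*K^m≤K*[1+K]^m K K))
  where
  double : ∀ K x → K * x + K * x ≡ K * (2 * x)
  double = solve-∀

[1+K]^w≤N*K^w⇒2^w≤N^K : ∀ K .{{_ : NonZero K}} N w → suc K ^ w ≤ N * K ^ w → 2 ^ w ≤ N ^ K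
[1+K]^w≤N*K^w⇒2^w≤N^K K N w [1+K]^w≤N*K^w =
  *-cancelʳ-≤ (2 ^ w) (N ^ K) ((K ^ K) ^ w) {{m^n≢0 (K ^ K) w {{m^n≢0 K K}}}} (begin
    2 ^ w * (K ^ K) ^ w   ≡⟨ ^-distribʳ-* 2 (K ^ K) w ⟨
    (2 * K ^ K) ^ w       ≤⟨ ^-monoˡ-≤ w (2*K^K≤[1+K]^K K) ⟩
    (suc K ^ K) ^ w       ≡⟨ ^-swap (suc K) K w ⟩
    (suc K ^ w) ^ K       ≤⟨ ^-monoˡ-≤ K [1+K]^w≤N*K^w ⟩
    (N * K ^ w) ^ K       ≡⟨ ^-distribʳ-* N (K ^ w) K ⟩
    N ^ K * (K ^ w) ^ K   ≡⟨ cong (N ^ K *_) (^-swap K w K) ⟩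
    N ^ K * (K ^ K) ^ w   ∎)
  where open ≤-Reasoning

-- Cutting the accepting paths of a uniform NROBP

module _ (G : Graph n) {w} (mw : MatchingWidth G w) (P : NROBP n)
         (uniform : Uniform P) (computes : Computes P (phi G)) where

  private
    B = prog P
  open import Data.List.Membership.DecPropositional (Fin._≟_ {n}) using (_∈?_)

  record Cut (a : Vec Bool n) (c : Fin (N B)) : Set where
    field
      front            : Path B (root P) c
      back             : Path B c (leaf P)
      front-consistent : All (Contains (lookup a)) (labels B front)
      back-consistent  : All (Contains (lookup a)) (labels B back)
      matching         : List (Fin n × Fin n)
      matching-cross   : IsCrossMatching G (_∈ vars B front) matching
      matching-size    : length matching ≡ w

  open Cut

  -- Opaque: only the type of cut is used, and unfolding it makes the fibre lemmas very slow to check.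
  opaque
    cut : ∀ a → Cover G a → ∃ (Cut a)
    cut a cov =
      let p , p-consistent = proj₂ computes (lookup a) cov
          σ , prefix⇔take = enumeration⇒ordering (readOnce P _ _ p) (proj₂ uniform p)
          k , M , M-cross , |M| = crossMatching-of-width G mw σ
          s = split p k
          front-vars : vars B (Split.front s) ≡ take k (vars B p)
          front-vars = trans (cong (List.map proj₁) (Split.front-labels s)) (sym (take-map k (labels B p)))
      in Split.mid s , record
        { front            = Split.front s
        ; back             = Split.back s
        ; front-consistent = subst (All _) (sym (Split.front-labels s)) (All.take⁺ k p-consistent)
        ; back-consistent  = subst (All _) (sym (Split.back-labels s)) (All.drop⁺ k p-consistent)
        ; matching         = M
        ; matching-cross   = crossMatching-resp G
                               (λ x → subst (λ L → Prefix σ k x ⇔ x ∈ L) (sym front-vars) (prefix⇔take k x))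
                               M-cross
        ; matching-size    = |M|
        }

  front-vars-uniform : ∀ {a b c} (I : Cut a c) (J : Cut b c) {x} → x ∈ vars B (front I) → x ∈ vars B (front J)
  front-vars-uniform I J {x} = Equivalence.to (proj₁ uniform _ (front I) (front J) x)

  module _ {a b c} (I : Cut a c) (J : Cut b c) where

    spliced : Fin n → Bool
    spliced x = if does (x ∈? vars B (front I)) then lookup a x else lookup b x

    spliced-front : ∀ {x} → x ∈ vars B (front I) → spliced x ≡ lookup a x
    spliced-front {x} x∈ with x ∈? vars B (front I)
    ... | yes _  = refl
    ... | no x∉  = ⊥-elim (x∉ x∈)

    spliced-back : ∀ {x} → x ∉ vars B (front I) → spliced x ≡ lookup b x
    spliced-back {x} x∉ with x ∈? vars B (front I)
    ... | yes x∈ = ⊥-elim (x∉ x∈)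
    ... | no _   = refl

    -- front I ++ back J is a read-once root-leaf path consistent with spliced.
    spliced-satisfies : phi G spliced
    spliced-satisfies = proj₁ computes (front I ++ᴾ back J) spliced
      (subst (All (Contains spliced)) (sym (labels-++ (front I) (back J)))
             (All.++⁺ (All.tabulate λ {(x , _)} x∈ →
                         trans (spliced-front (∈-map⁺ proj₁ x∈)) (All.lookup (front-consistent I) x∈))
                      (All.tabulate λ {(x , _)} x∈ →
                         trans (spliced-back (λ x∈front → disjoint x∈front (∈-map⁺ proj₁ x∈)))
                               (All.lookup (back-consistent J) x∈))))
      where
      disjoint : ∀ {x} → x ∈ vars B (front I) → x ∉ vars B (back J)
      disjoint = unique-++⇒disjoint (vars B (front I))
                   (subst Unique (vars-++ (front I) (back J)) (readOnce P _ _ (front I ++ᴾ back J)))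

    cut-edge : ∀ {u v} → Edge G u v → u ∈ vars B (front I) → v ∉ vars B (front I) →
      lookup a u ≡ false → lookup b v ≡ true
    cut-edge uv u∈ v∉ a-u-false with spliced-satisfies _ _ uv
    ... | inj₁ u-true with () ← trans (sym a-u-false) (trans (sym (spliced-front u∈)) u-true)
    ... | inj₂ v-true = trans (sym (spliced-back v∉)) v-true

  cutNode : Vec Bool n → Fin (N B)
  cutNode a with cover? G a
  ... | yes cov = proj₁ (cut a cov)
  ... | no _    = root P

  InFibre : Fin (N B) → Pred (Vec Bool n) 0ℓ
  InFibre c a = Cover G a × cutNode a ≡ c

  inFibre? : ∀ c → Decidable (InFibre c)
  inFibre? c = cover? G ∩? λ a → cutNode a Fin.≟ c

  cut-at : ∀ {a c} → InFibre c a → Cut a c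
  cut-at {a} (cov , refl) with cover? G a
  ... | yes cov′ = proj₂ (cut a cov′)
  ... | no ¬cov  = ⊥-elim (¬cov cov)

  module _ {a₀ c} (I₀ : Cut a₀ c) where

    -- An endpoint of each matching edge that is true in every cover of the fibre over c.
    chosen : Fin n × Fin n → Fin n
    chosen (u , v) with satisfiable? (inFibre? c ∩? λ a → lookup a u ≟ᴮ false)
    ... | yes _ = v
    ... | no _  = u

    chosen-endpoint : ∀ e → chosen e ≡ proj₁ e ⊎ chosen e ≡ proj₂ e
    chosen-endpoint (u , v) with satisfiable? (inFibre? c ∩? λ a → lookup a u ≟ᴮ false)
    ... | yes _ = inj₂ refl
    ... | no _  = inj₁ refl

    chosen-true : ∀ {a u v} → InFibre c a → Edge G u v → u ∈ vars B (front I₀) → v ∉ vars B (front I₀) →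
      lookup a (chosen (u , v)) ≡ true
    chosen-true {a} {u} {v} a∈c uv u∈ v∉ with satisfiable? (inFibre? c ∩? λ a → lookup a u ≟ᴮ false)
    ... | yes (b , b∈c , b-u-false) =
      cut-edge (cut-at b∈c) (cut-at a∈c) uv (front-vars-uniform I₀ (cut-at b∈c) u∈)
               (v∉ ∘ front-vars-uniform (cut-at b∈c) I₀) b-u-false
    ... | no ∄ with lookup a u in a-u
    ...   | true  = refl
    ...   | false = ⊥-elim (∄ (a , a∈c , a-u))

  private
    K = 2 ^ maxDegree G

    2^degree≤K : ∀ d → 2 ^ degree G d ≤ K
    2^degree≤K d = ^-monoʳ-≤ 2 (degree≤maxDegree G d)

  fibre-bound : ∀ c → count (inFibre? c) * suc K ^ w ≤ K ^ w * count (cover? G)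
  fibre-bound c with satisfiable? (inFibre? c)
  ... | no ∄ rewrite n≤0⇒n≡0 (≮⇒≥ (∄ ∘ 0<count⇒satisfiable (inFibre? c))) = z≤n
  ... | yes (a₀ , a₀∈c) =
    subst (λ l → count (inFibre? c) * suc K ^ l ≤ K ^ l * count (cover? G))
          (trans (length-map (chosen I₀) (matching I₀)) (matching-size I₀))
          (≤-trans (*-monoˡ-≤ (suc K ^ length D) (count-mono (inFibre? c) (coverContaining? G D) fibre⊆))
                   (count-coverContaining G 2^degree≤K D!))
    where
    I₀ = cut-at a₀∈c
    D = List.map (chosen I₀) (matching I₀)
    D! : Unique D
    D! = endpoint-choice-unique G (chosen I₀) (chosen-endpoint I₀) (matching-cross I₀)
    fibre⊆ : InFibre c ⊆ CoverContaining G D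
    fibre⊆ a∈c = proj₁ a∈c ,
      All.map⁺ (All.map (λ (uv , u∈ , v∉) → chosen-true I₀ a∈c uv u∈ v∉) (proj₁ (matching-cross I₀)))

  2^w≤nodes^K : 2 ^ w ≤ nodes P ^ K
  2^w≤nodes^K = [1+K]^w≤N*K^w⇒2^w≤N^K K {{m^n≢0 2 (maxDegree G)}} (N B) w
    (*-cancelʳ-≤ (suc K ^ w) (N B * K ^ w) c₀ {{>-nonZero 0<c₀}} (begin
      suc K ^ w * c₀        ≡⟨ *-comm (suc K ^ w) c₀ ⟩
      c₀ * suc K ^ w        ≤⟨ count*-≤ (cover? G) cutNode fibre-bound ⟩
      N B * (K ^ w * c₀)    ≡⟨ *-assoc (N B) (K ^ w) c₀ ⟨
      N B * K ^ w * c₀      ∎))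
    where
    open ≤-Reasoning
    c₀ = count (cover? G)
    0<c₀ : 0 < c₀
    0<c₀ = ∈⇒0<count (cover? G) {replicate n true} λ u _ _ → inj₁ (lookup-replicate u true)

-- Isolated vertices occur in no clause of phi G, so the bound needs no hypothesis on them.
theorem2 : Σ (ℕ → ℕ) λ f → (∀ x → 1 ≤ f x) ×
    (∀ {n} (G : Graph n) → NoIsolatedVertices G →
      ∀ (w : ℕ) → MatchingWidth G w →
      ∀ (P : NROBP n) → Uniform P → Computes P (phi G) →
      2 ^ w ≤ nodes P ^ f (maxDegree G))
theorem2 = (2 ^_) , m^n>0 2 , λ G _ w mw P uniform computes → 2^w≤nodes^K G mw P uniform computes
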